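{- The proportion of graphs of girth at least five on vertex set $\{1,\dots,n\}$ whose maximum degree exceeds $\frac{n}{\log\log n}$ is $2^{ -\omega(n)}$ as $n\to\infty$.
   Context: Girth at least five means no cycle of length 3 or 4. $\log$ denotes $\log_2$. $2^{ -\omega(n)}$ means $2^{ -g(n)}$ with $g(n)/n\to\infty$. -}

module Defs where

open import Data.Nat using (ℕ; zero; suc; _+_; _*_; _^_; _<_; _≤_; _≤ᵇ_)
open import Data.Fin using (Fin; zero; suc; _≟_)
open import Data.Bool using (Bool; true; false; not; _∧_; if_then_else_)
open import Data.Unit using (⊤; tt)
open import Data.Product using (Σ; _×_; _,_)
open import Data.Vec using (Vec; []; _∷_; lookup)
open import Data.List using (List; []; _∷_; [_]; map; concatMap; length; filterᵇ; allFin)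
open import Data.Nat.ListAction using (sum)
open import Data.Bool.ListAction using (any)
open import Relation.Nullary.Decidable using (⌊_⌋)

-- Labelled simple graphs on vertex set Fin n, encoded canonically:
-- a graph on suc n vertices is a graph on the vertices suc i (old vertices)
-- together with the neighbourhood (a Vec Bool n) of the new vertex zero.
-- This encoding is a bijection with simple graphs on n labelled vertices.
Graph : ℕ → Set
Graph zero = ⊤
Graph (suc n) = Graph n × Vec Bool n

adj : ∀ {n} → Graph n → Fin n → Fin n → Bool
adj {suc n} (G , s) zero zero = false
adj {suc n} (G , s) zero (suc j) = lookup s j
adj {suc n} (G , s) (suc i) zero = lookup s i
adj {suc n} (G , s) (suc i) (suc j) = adj G i j

allVecs : (n : ℕ) → List (Vec Bool n)
allVecs zero = [ [] ]
allVecs (suc n) = concatMap (λ v → (false ∷ v) ∷ (true ∷ v) ∷ []) (allVecs n)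

allGraphs : (n : ℕ) → List (Graph n)
allGraphs zero = [ tt ]
allGraphs (suc n) = concatMap (λ G → map (λ s → G , s) (allVecs n)) (allGraphs n)

deg : ∀ {n} → Graph n → Fin n → ℕ
deg {n} G i = sum (map (λ j → if adj G i j then 1 else 0) (allFin n))

maxDegAtLeast : ∀ {n} → Graph n → ℕ → Bool
maxDegAtLeast {n} G d = any (λ i → d ≤ᵇ deg G i) (allFin n)

neq : ∀ {n} → Fin n → Fin n → Bool
neq i j = not ⌊ i ≟ j ⌋

-- contains a triangle (adjacency is irreflexive, so vertices are distinct)
hasTriangle : ∀ {n} → Graph n → Bool
hasTriangle {n} G =
  any (λ a → any (λ b → any (λ c → adj G a b ∧ adj G b c ∧ adj G c a)
    (allFin n)) (allFin n)) (allFin n)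

hasC4 : ∀ {n} → Graph n → Bool
hasC4 {n} G =
  any (λ a → any (λ b → any (λ c → any (λ d →
    adj G a b ∧ adj G b c ∧ adj G c d ∧ adj G d a ∧ neq a c ∧ neq b d)
    (allFin n)) (allFin n)) (allFin n)) (allFin n)

girth≥5 : ∀ {n} → Graph n → Bool
girth≥5 G = not (hasTriangle G) ∧ not (hasC4 G)

countGirth5 : ℕ → ℕ
countGirth5 n = length (filterᵇ girth≥5 (allGraphs n))

countGirth5MaxDeg≥ : ℕ → ℕ → ℕ
countGirth5MaxDeg≥ n d =
  length (filterᵇ (λ G → girth≥5 G ∧ maxDegAtLeast G d) (allGraphs n))

-- BigDeg n d  expresses  d > n / log₂ (log₂ n)  (for n ≥ 3, where log₂ log₂ n > 0)
-- exactly, without reals:  d > n / L  ⟺  log₂ n > 2^(n/d)  ⟺ there is a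
-- rational r = a/b with 2^(n/d) < r < log₂ n, i.e. 2^n·b^d < a^d and 2^a < n^b.
BigDeg : ℕ → ℕ → Set
BigDeg n d = Σ ℕ λ a → Σ ℕ λ b → (2 ^ n * b ^ d < a ^ d) × (2 ^ a < n ^ b)

-- Let G have girth ≥ 5 and a vertex v of degree ≥ d, and let T = {v} ∪ S for a set S of m − 1
-- neighbours of v.  Girth ≥ 5 makes G rigid around T: S is independent and every vertex outside T
-- has at most one neighbour in T.  So G is determined by T, by the map sending each vertex to its
-- neighbour in T (if any), and by G − T: about (m + n) log n bits besides G − T.
-- Replace T by a spanning subgraph of the incidence graph of the points and lines y = s x + c,
-- which is bipartite and C₄-free with m = 3a³ vertices and a⁴ edges, and put G − T on the other
-- n − m vertices.  The a⁴ edge bits store the (m + n) log n bits above together with C n free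
-- bits; every graph produced has girth ≥ 5 and gives back G and the free bits.  Hence 2^(C n)
-- times the number of such G is at most the number of graphs of girth ≥ 5.  With m ≈ n / log n,
-- which is less than d, there are a⁴ ≈ (n / log n)^(4/3) ≫ (C + log n) n bits available.

module Submission where

open import Defs
open import Data.Bool using (Bool; true; false; not; _∧_; _∨_; if_then_else_; T; T?)
open import Data.Bool.ListAction using (any)
open import Data.Bool.Properties using (not-¬; not-involutive; ∨-comm; ∨-identityʳ; ∧-identityʳ; ∧-zeroʳ; T-∧; T-∨; T-≡; T-not-≡)
open import Data.Empty using (⊥; ⊥-elim)
open import Data.Fin using (Fin; zero; suc; toℕ; fromℕ<; inject≤; remQuot; combine; _≟_)
open import Data.Fin.Properties using (toℕ<n; toℕ-injective; toℕ-inject≤; toℕ-fromℕ<; inject≤-injective; injective⇒≤; combine-remQuot)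
open import Data.List using (List; []; _∷_; _++_; map; concatMap; length; lookup; take; head; filter; filterᵇ; allFin; cartesianProductWith; cartesianProduct)
open import Data.List.Membership.Propositional using (_∈_; _∉_; find; lose)
open import Data.List.Membership.Propositional.Properties using (∈-lookup; ∈-allFin; ∈-map⁻; ∈-filter⁺; ∈-filter⁻; ∈-++⁺ˡ; ∈-++⁺ʳ; ∈-cartesianProductWith⁺)
import Data.List.Membership.DecPropositional as DecMembership
import Data.List.Membership.Setoid.Properties as SetoidMembership
open import Data.List.Properties using (length-++; length-map; length-take; length-tabulate; ∷-injective; ∷-injectiveˡ; ∷-injectiveʳ)
open import Data.List.Relation.Unary.All as All using ([]; _∷_)
open import Data.List.Relation.Unary.All.Properties using (¬Any⇒All¬)
open import Data.List.Relation.Unary.AllPairs using ([]; _∷_)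
open import Data.List.Relation.Unary.Any using (here; there; index; satisfied)
open import Data.List.Relation.Unary.Any.Properties using (any⁺; any⁻; lookup-index)
open import Data.List.Relation.Unary.Unique.Propositional using (Unique)
import Data.List.Relation.Unary.Unique.Propositional.Properties as Unique
open import Data.Maybe using (just; nothing; maybe′; fromMaybe)
open import Data.Nat using (ℕ; zero; suc; _+_; _*_; _∸_; _^_; _⊓_; _<_; _≤_; _<?_; _≤?_; _≤ᵇ_; _<ᵇ_; z≤n; s≤s; NonZero)
import Data.Nat as ℕ using (_≟_)
open import Data.Nat.DivMod using (_%_; [m+kn]%n≡m%n; m<n⇒m%n≡m)
open import Data.Nat.ListAction using (sum)
open import Data.Nat.Properties hiding (_≟_)
open import Data.Nat.Solver using (module +-*-Solver)
open import Data.Product using (Σ; _×_; _,_; proj₁; proj₂; uncurry)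
open import Data.Product.Properties using (,-injectiveˡ; ,-injectiveʳ; ≡-dec)
open import Data.Sum using (_⊎_; inj₁; inj₂; [_,_]′)
open import Data.Unit using (tt)
open import Data.Vec as Vec using (Vec; []; _∷_; toList)
import Data.Vec.Properties as Vecₚ
open import Function using (_∘_; id; Equivalence)
open import Relation.Binary.Definitions using (DecidableEquality; tri<; tri≈; tri>)
open import Relation.Binary.PropositionalEquality using (_≡_; _≢_; refl; sym; trans; cong; cong₂; subst; subst₂; setoid; module ≡-Reasoning)
open import Relation.Nullary using (¬_; yes; no)
open import Relation.Nullary.Decidable using (⌊_⌋; toWitness; fromWitnessFalse; toWitnessFalse)

open Equivalence using (to; from)
open +-*-Solver using (solve; _:+_; _:*_; _:^_; _:=_; con)

-- Counting by injections

module _ {A : Set} where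

  lookup-injective : ∀ {xs : List A} → Unique xs → ∀ {i j} → lookup xs i ≡ lookup xs j → i ≡ j
  lookup-injective (_  ∷ _) {zero}  {zero}  _  = refl
  lookup-injective (x∉ ∷ _) {zero}  {suc j} eq = ⊥-elim (All.lookup x∉ (∈-lookup j) eq)
  lookup-injective (x∉ ∷ _) {suc i} {zero}  eq = ⊥-elim (All.lookup x∉ (∈-lookup i) (sym eq))
  lookup-injective (_  ∷ u) {suc i} {suc j} eq = cong suc (lookup-injective u eq)

module _ {A B : Set} {xs : List A} {zs : List B} where

  open SetoidMembership using (index-injective)

  length-≤-injection : Unique xs → (f : A → B) → (into : ∀ {x} → x ∈ xs → f x ∈ zs) →
                       (∀ {x x′} → x ∈ xs → x′ ∈ xs → f x ≡ f x′ → x ≡ x′) →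
                       length xs ≤ length zs
  length-≤-injection u f into inj = injective⇒≤ {f = position} position-injective
    where
    position : Fin (length xs) → Fin (length zs)
    position i = index (into (∈-lookup i))
    position-injective : ∀ {i j} → position i ≡ position j → i ≡ j
    position-injective {i} {j} eq = lookup-injective u
      (inj (∈-lookup i) (∈-lookup j) (index-injective (setoid B) (into (∈-lookup i)) (into (∈-lookup j)) eq))

module _ {A B C : Set} {xs : List A} {ys : List B} {zs : List C} where

  open SetoidMembership using (index-injective)

  length-*-≤-injection : Unique xs → Unique ys → (f : A → B → C) →
                         (into : ∀ {x y} → x ∈ xs → y ∈ ys → f x y ∈ zs) →
                         (∀ {x x′ y y′} → x ∈ xs → x′ ∈ xs → y ∈ ys → y′ ∈ ys →
                            f x y ≡ f x′ y′ → x ≡ x′ × y ≡ y′) →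
                         length xs * length ys ≤ length zs
  length-*-≤-injection ux uy f into inj = injective⇒≤ {f = position ∘ remQuot (length ys)}
    (remQuot-injective ∘ pair-injective)
    where
    position : Fin (length xs) × Fin (length ys) → Fin (length zs)
    position (i , j) = index (into (∈-lookup i) (∈-lookup j))
    pair-injective : ∀ {p q} → position p ≡ position q → p ≡ q
    pair-injective {i , j} {i′ , j′} eq =
      let x≡x′ , y≡y′ = inj (∈-lookup i) (∈-lookup i′) (∈-lookup j) (∈-lookup j′)
                          (index-injective (setoid C) (into (∈-lookup i) (∈-lookup j))
                                                      (into (∈-lookup i′) (∈-lookup j′)) eq)
      in cong₂ _,_ (lookup-injective ux x≡x′) (lookup-injective uy y≡y′)
    remQuot-injective : ∀ {k l} → remQuot (length ys) k ≡ remQuot (length ys) l → k ≡ l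
    remQuot-injective {k} {l} eq =
      trans (sym (combine-remQuot {length xs} (length ys) k))
            (trans (cong (uncurry combine) eq) (combine-remQuot {length xs} (length ys) l))

module _ {A B C : Set} (f : A → B → C) where

  concatMap-map≡cartesianProductWith : ∀ xs ys →
    concatMap (λ x → map (f x) ys) xs ≡ cartesianProductWith f xs ys
  concatMap-map≡cartesianProductWith []       ys = refl
  concatMap-map≡cartesianProductWith (x ∷ xs) ys =
    cong (map (f x) ys ++_) (concatMap-map≡cartesianProductWith xs ys)

  length-cartesianProductWith : ∀ xs ys → length (cartesianProductWith f xs ys) ≡ length xs * length ys
  length-cartesianProductWith []       ys = refl
  length-cartesianProductWith (x ∷ xs) ys = begin
    length (map (f x) ys ++ cartesianProductWith f xs ys)  ≡⟨ length-++ (map (f x) ys) ⟩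
    length (map (f x) ys) + length (cartesianProductWith f xs ys)
      ≡⟨ cong₂ _+_ (length-map (f x) ys) (length-cartesianProductWith xs ys) ⟩
    length ys + length xs * length ys  ∎
    where open ≡-Reasoning

prepend : ∀ {n} → Vec Bool n → Bool → Vec Bool (suc n)
prepend v b = b ∷ v

booleans : List Bool
booleans = false ∷ true ∷ []

allVecs-step : ∀ n → allVecs (suc n) ≡ cartesianProductWith prepend (allVecs n) booleans
allVecs-step n = concatMap-map≡cartesianProductWith prepend (allVecs n) booleans

allGraphs-step : ∀ n → allGraphs (suc n) ≡ cartesianProduct (allGraphs n) (allVecs n)
allGraphs-step n = concatMap-map≡cartesianProductWith _,_ (allGraphs n) (allVecs n)

∈-booleans : ∀ b → b ∈ booleans
∈-booleans false = here refl
∈-booleans true  = there (here refl)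

allVecs-complete : ∀ {n} (v : Vec Bool n) → v ∈ allVecs n
allVecs-complete []      = here refl
allVecs-complete {suc n} (b ∷ v) =
  subst (b ∷ v ∈_) (sym (allVecs-step n))
        (∈-cartesianProductWith⁺ prepend (allVecs-complete v) (∈-booleans b))

booleans-unique : Unique booleans
booleans-unique = ((λ ()) ∷ []) ∷ [] ∷ []

allVecs-unique : ∀ n → Unique (allVecs n)
allVecs-unique zero    = [] ∷ []
allVecs-unique (suc n) = subst Unique (sym (allVecs-step n))
  (Unique.cartesianProductWith⁺ prepend (λ e → let b≡ , v≡ = Vecₚ.∷-injective e in v≡ , b≡)
    (allVecs-unique n) booleans-unique)

length-allVecs : ∀ n → length (allVecs n) ≡ 2 ^ n
length-allVecs zero    = refl
length-allVecs (suc n) = begin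
  length (allVecs (suc n))
    ≡⟨ cong length (allVecs-step n) ⟩
  length (cartesianProductWith prepend (allVecs n) booleans)
    ≡⟨ length-cartesianProductWith prepend (allVecs n) booleans ⟩
  length (allVecs n) * 2  ≡⟨ cong (_* 2) (length-allVecs n) ⟩
  2 ^ n * 2               ≡⟨ *-comm (2 ^ n) 2 ⟩
  2 ^ suc n               ∎
  where open ≡-Reasoning

allGraphs-complete : ∀ {n} (G : Graph n) → G ∈ allGraphs n
allGraphs-complete {zero}  tt      = here refl
allGraphs-complete {suc n} (G , s) =
  subst ((G , s) ∈_) (sym (allGraphs-step n))
        (∈-cartesianProductWith⁺ _,_ (allGraphs-complete G) (allVecs-complete s))

allGraphs-unique : ∀ n → Unique (allGraphs n)
allGraphs-unique zero    = [] ∷ []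
allGraphs-unique (suc n) = subst Unique (sym (allGraphs-step n))
  (Unique.cartesianProduct⁺ (allGraphs-unique n) (allVecs-unique n))

-- Girth at least five

module _ {V : Set} (E : V → V → Set) where

  TriangleFree : Set
  TriangleFree = ∀ {a b c} → E a b → E b c → E c a → ⊥

  C4Free : Set
  C4Free = ∀ {a b c d} → E a b → E b c → E c d → E d a → a ≢ c → b ≢ d → ⊥

Adj : ∀ {n} → Graph n → Fin n → Fin n → Set
Adj G i j = T (adj G i j)

adj-sym : ∀ {n} (G : Graph n) i j → adj G i j ≡ adj G j i
adj-sym {suc n} G       zero    zero    = refl
adj-sym {suc n} G       zero    (suc j) = refl
adj-sym {suc n} G       (suc i) zero    = refl
adj-sym {suc n} (G , _) (suc i) (suc j) = adj-sym G i j

adj-irrefl : ∀ {n} (G : Graph n) i → adj G i i ≡ false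
adj-irrefl {suc n} G       zero    = refl
adj-irrefl {suc n} (G , _) (suc i) = adj-irrefl G i

vec-ext : ∀ {A : Set} {n} {s s′ : Vec A n} → (∀ j → Vec.lookup s j ≡ Vec.lookup s′ j) → s ≡ s′
vec-ext {s = s} {s′} eq =
  trans (sym (Vecₚ.tabulate∘lookup s)) (trans (Vecₚ.tabulate-cong eq) (Vecₚ.tabulate∘lookup s′))

adj-ext : ∀ {n} {G G′ : Graph n} → (∀ i j → adj G i j ≡ adj G′ i j) → G ≡ G′
adj-ext {zero}              eq = refl
adj-ext {suc n} {G , s} {G′ , s′} eq =
  cong₂ _,_ (adj-ext (λ i j → eq (suc i) (suc j))) (vec-ext (λ j → eq zero (suc j)))

fromAdj : ∀ {n} → (Fin n → Fin n → Bool) → Graph n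
fromAdj {zero}  A = tt
fromAdj {suc n} A = fromAdj (λ i j → A (suc i) (suc j)) , Vec.tabulate (λ j → A zero (suc j))

adj-fromAdj : ∀ {n} (A : Fin n → Fin n → Bool) → (∀ i j → A i j ≡ A j i) → (∀ i → A i i ≡ false) →
              ∀ i j → adj (fromAdj A) i j ≡ A i j
adj-fromAdj {suc n} A sym-A irr-A zero    zero    = sym (irr-A zero)
adj-fromAdj {suc n} A sym-A irr-A zero    (suc j) = Vecₚ.lookup∘tabulate (λ j → A zero (suc j)) j
adj-fromAdj {suc n} A sym-A irr-A (suc i) zero    =
  trans (Vecₚ.lookup∘tabulate (λ j → A zero (suc j)) i) (sym-A zero (suc i))
adj-fromAdj {suc n} A sym-A irr-A (suc i) (suc j) =
  adj-fromAdj (λ i j → A (suc i) (suc j)) (λ i j → sym-A (suc i) (suc j)) (λ i → irr-A (suc i)) i j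

sum-indicator≡length-filterᵇ : ∀ {A : Set} (p : A → Bool) xs →
  sum (map (λ x → if p x then 1 else 0) xs) ≡ length (filterᵇ p xs)
sum-indicator≡length-filterᵇ p []       = refl
sum-indicator≡length-filterᵇ p (x ∷ xs) with p x
... | true  = cong suc (sum-indicator≡length-filterᵇ p xs)
... | false = sum-indicator≡length-filterᵇ p xs

neighbours : ∀ {n} → Graph n → Fin n → List (Fin n)
neighbours {n} G v = filterᵇ (adj G v) (allFin n)

deg≡length-neighbours : ∀ {n} (G : Graph n) v → deg G v ≡ length (neighbours G v)
deg≡length-neighbours {n} G v = sum-indicator≡length-filterᵇ (adj G v) (allFin n)

T-not⇒¬T : ∀ {b} → T (not b) → ¬ T b
T-not⇒¬T {true} ()

¬T⇒T-not : ∀ {b} → ¬ T b → T (not b)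
¬T⇒T-not {true}  ¬b = ¬b tt
¬T⇒T-not {false} ¬b = tt

module _ {n} (G : Graph n) where

  private
    neq⁺ : ∀ {a c : Fin n} → a ≢ c → T (neq a c)
    neq⁺ {a} {c} = fromWitnessFalse {a? = a ≟ c}

    neq⁻ : ∀ {a c : Fin n} → T (neq a c) → a ≢ c
    neq⁻ {a} {c} = toWitnessFalse {a? = a ≟ c}

    any-allFin⁺ : ∀ (p : Fin n → Bool) {a} → T (p a) → T (any p (allFin n))
    any-allFin⁺ p {a} pa = any⁺ p (lose (∈-allFin a) pa)

    any-allFin⁻ : ∀ (p : Fin n → Bool) → T (any p (allFin n)) → Σ (Fin n) λ a → T (p a)
    any-allFin⁻ p h = satisfied (any⁻ p (allFin n) h)

  girth≥5⇒triangleFree : T (girth≥5 G) → TriangleFree (Adj G)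
  girth≥5⇒triangleFree g ab bc ca = T-not⇒¬T (proj₁ (to T-∧ g))
    (any-allFin⁺ _ (any-allFin⁺ _ (any-allFin⁺ _ (from T-∧ (ab , from T-∧ (bc , ca))))))

  girth≥5⇒C4Free : T (girth≥5 G) → C4Free (Adj G)
  girth≥5⇒C4Free g ab bc cd da a≢c b≢d = T-not⇒¬T (proj₂ (to T-∧ g))
    (any-allFin⁺ _ (any-allFin⁺ _ (any-allFin⁺ _ (any-allFin⁺ _
      (from T-∧ (ab , from T-∧ (bc , from T-∧ (cd , from T-∧ (da , from T-∧ (neq⁺ a≢c , neq⁺ b≢d))))))))))

  triangleFree∧C4Free⇒girth≥5 : TriangleFree (Adj G) → C4Free (Adj G) → T (girth≥5 G)
  triangleFree∧C4Free⇒girth≥5 tf c4f = from T-∧ (¬T⇒T-not no-triangle , ¬T⇒T-not no-C4)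
    where
    no-triangle : ¬ T (hasTriangle G)
    no-triangle h =
      let _ , h₁ = any-allFin⁻ _ h ; _ , h₂ = any-allFin⁻ _ h₁ ; _ , h₃ = any-allFin⁻ _ h₂
          ab , h₄ = to T-∧ h₃ ; bc , ca = to T-∧ h₄
      in tf ab bc ca
    no-C4 : ¬ T (hasC4 G)
    no-C4 h =
      let _ , h₁ = any-allFin⁻ _ h ; _ , h₂ = any-allFin⁻ _ h₁
          _ , h₃ = any-allFin⁻ _ h₂ ; _ , h₄ = any-allFin⁻ _ h₃
          ab , h₅ = to T-∧ h₄ ; bc , h₆ = to T-∧ h₅ ; cd , h₇ = to T-∧ h₆ ; da , h₈ = to T-∧ h₇
          a≢c , b≢d = to T-∧ h₈
      in c4f ab bc cd da (neq⁻ a≢c) (neq⁻ b≢d)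

module _ {V : Set} {E F : V → V → Set} (E⊆F : ∀ {a b} → E a b → F a b) where

  triangleFree-⊆ : TriangleFree F → TriangleFree E
  triangleFree-⊆ tf ab bc ca = tf (E⊆F ab) (E⊆F bc) (E⊆F ca)

  C4Free-⊆ : C4Free F → C4Free E
  C4Free-⊆ c4f ab bc cd da = c4f (E⊆F ab) (E⊆F bc) (E⊆F cd) (E⊆F da)

C4Free-comap : ∀ {W V : Set} {E : V → V → Set} (f : W → V) → (∀ {a b} → f a ≡ f b → a ≡ b) →
               C4Free E → C4Free (λ a b → E (f a) (f b))
C4Free-comap f f-inj c4f ab bc cd da a≢c b≢d = c4f ab bc cd da (a≢c ∘ f-inj) (b≢d ∘ f-inj)

bipartite⇒triangleFree : ∀ {V : Set} {E : V → V → Set} (side : V → Bool) →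
                         (∀ {a b} → E a b → side b ≡ not (side a)) → TriangleFree E
bipartite⇒triangleFree side flips {a} ab bc ca =
  not-¬ refl (trans (flips ca) (trans (cong not (trans (flips bc) (cong not (flips ab))))
                                      (not-involutive (not (side a)))))

module Levi {V : Set} (isPoint : V → Bool) (On : V → V → Set)
  (sides  : ∀ {p q} → On p q → isPoint p ≡ true × isPoint q ≡ false)
  (linear : ∀ {p p′ q q′} → On p q → On p′ q → On p q′ → On p′ q′ → p ≡ p′ ⊎ q ≡ q′) where

  Levi : V → V → Set
  Levi p q = On p q ⊎ On q p

  private
    true≢false : true ≢ false
    true≢false ()

    on-from-point : ∀ {p q} → Levi p q → isPoint p ≡ true → On p q
    on-from-point (inj₁ o) _  = o
    on-from-point (inj₂ o) pt = ⊥-elim (true≢false (trans (sym pt) (proj₂ (sides o))))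

    on-from-line : ∀ {p q} → Levi p q → isPoint p ≡ false → On q p
    on-from-line (inj₂ o) _  = o
    on-from-line (inj₁ o) pf = ⊥-elim (true≢false (trans (sym (proj₁ (sides o))) pf))

    flips : ∀ {p q} → Levi p q → isPoint q ≡ not (isPoint p)
    flips (inj₁ o) = trans (proj₂ (sides o)) (cong not (sym (proj₁ (sides o))))
    flips (inj₂ o) = trans (proj₁ (sides o)) (cong not (sym (proj₂ (sides o))))

    C4-through-point : ∀ {a b c d} → isPoint a ≡ true →
                       Levi a b → Levi b c → Levi c d → Levi d a → a ≢ c → b ≢ d → ⊥
    C4-through-point pa ab bc cd da a≢c b≢d = [ a≢c , b≢d ]′ (linear oab ocb oad ocd)
      where
      oab = on-from-point ab pa
      ocb = on-from-line bc (proj₂ (sides oab))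
      ocd = on-from-point cd (proj₁ (sides ocb))
      oad = on-from-line da (proj₂ (sides ocd))

  levi-triangleFree : TriangleFree Levi
  levi-triangleFree = bipartite⇒triangleFree isPoint flips

  levi-C4Free : C4Free Levi
  levi-C4Free {a} {b} ab bc cd da a≢c b≢d with isPoint a in pa
  ... | true  = C4-through-point pa ab bc cd da a≢c b≢d
  ... | false = C4-through-point (proj₁ (sides (on-from-line ab pa))) bc cd da ab b≢d (a≢c ∘ sym)

module DisjointUnion {V : Set} (low : V → Bool) (E₁ E₂ : V → V → Bool) where

  union : V → V → Bool
  union u v = if low u then low v ∧ E₁ u v else not (low v) ∧ E₂ u v

  union-low : ∀ {u v} → T (low u) → T (low v) → union u v ≡ E₁ u v
  union-low {u} {v} _ _ with low u | low v
  ... | true | true = refl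

  union-high : ∀ {u v} → ¬ T (low u) → ¬ T (low v) → union u v ≡ E₂ u v
  union-high {u} {v} hu hv with low u | low v
  ... | true  | _     = ⊥-elim (hu _)
  ... | false | true  = ⊥-elim (hv _)
  ... | false | false = refl

  union-sym : (∀ u v → E₁ u v ≡ E₁ v u) → (∀ u v → E₂ u v ≡ E₂ v u) → ∀ u v → union u v ≡ union v u
  union-sym sym₁ sym₂ u v with low u | low v
  ... | true  | true  = sym₁ u v
  ... | true  | false = refl
  ... | false | true  = refl
  ... | false | false = sym₂ u v

  union-irrefl : (∀ u → E₁ u u ≡ false) → (∀ u → E₂ u u ≡ false) → ∀ u → union u u ≡ false
  union-irrefl irr₁ irr₂ u with low u
  ... | true  = irr₁ u
  ... | false = irr₂ u

  private
    stays-low : ∀ {u v} → T (low u) → T (union u v) → T (low v) × T (E₁ u v)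
    stays-low {u} _ e with low u
    ... | true = to T-∧ e

    stays-high : ∀ {u v} → ¬ T (low u) → T (union u v) → ¬ T (low v) × T (E₂ u v)
    stays-high {u} hu e with low u
    ... | true  = ⊥-elim (hu _)
    ... | false = let hv , e₂ = to T-∧ e in T-not⇒¬T hv , e₂

  union-triangleFree : TriangleFree (λ u v → T (E₁ u v)) → TriangleFree (λ u v → T (E₂ u v)) →
                       TriangleFree (λ u v → T (union u v))
  union-triangleFree tf₁ tf₂ {a} ab bc ca with T? (low a)
  ... | yes la = let lb , ab₁ = stays-low la ab ; lc , bc₁ = stays-low lb bc ; _ , ca₁ = stays-low lc ca
                 in tf₁ ab₁ bc₁ ca₁
  ... | no ha  = let hb , ab₂ = stays-high ha ab ; hc , bc₂ = stays-high hb bc ; _ , ca₂ = stays-high hc ca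
                 in tf₂ ab₂ bc₂ ca₂

  union-C4Free : C4Free (λ u v → T (E₁ u v)) → C4Free (λ u v → T (E₂ u v)) →
                 C4Free (λ u v → T (union u v))
  union-C4Free c4f₁ c4f₂ {a} ab bc cd da with T? (low a)
  ... | yes la = let lb , ab₁ = stays-low la ab ; lc , bc₁ = stays-low lb bc
                     ld , cd₁ = stays-low lc cd ; _ , da₁ = stays-low ld da
                 in c4f₁ ab₁ bc₁ cd₁ da₁
  ... | no ha  = let hb , ab₂ = stays-high ha ab ; hc , bc₂ = stays-high hb bc
                     hd , cd₂ = stays-high hc cd ; _ , da₂ = stays-high hd da
                 in c4f₂ ab₂ bc₂ cd₂ da₂

-- Points and lines

radix-bound : ∀ {a x y Y} → x < a → y < Y → x + y * a < Y * a
radix-bound {a} {x} {y} x<a y<Y = ≤-trans (+-monoˡ-< (y * a) x<a) (*-monoˡ-≤ a y<Y)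

radix-injective : ∀ {a x y x′ y′} → x < a → x′ < a → x + y * a ≡ x′ + y′ * a → x ≡ x′ × y ≡ y′
radix-injective {suc a} {x} {y} {x′} {y′} x<a x′<a eq = x≡x′ , y≡y′
  where
  open ≡-Reasoning
  x≡x′ : x ≡ x′
  x≡x′ = begin
    x                    ≡⟨ m<n⇒m%n≡m x<a ⟨
    x % suc a            ≡⟨ [m+kn]%n≡m%n x y (suc a) ⟨
    (x + y * suc a) % suc a    ≡⟨ cong (_% suc a) eq ⟩
    (x′ + y′ * suc a) % suc a  ≡⟨ [m+kn]%n≡m%n x′ y′ (suc a) ⟩
    x′ % suc a           ≡⟨ m<n⇒m%n≡m x′<a ⟩
    x′                   ∎
  y≡y′ : y ≡ y′
  y≡y′ = *-cancelʳ-≡ y y′ (suc a) (+-cancelˡ-≡ x _ _ (trans eq (cong (_+ y′ * suc a) (sym x≡x′))))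

-- With s < t and x < y the two sides differ by (t − s)(y − x) > 0.
cross-product-< : ∀ {s t x y} → s < t → x < y → s * x + t * y ≢ t * x + s * y
cross-product-< {s} {t} {x} {y} s<t x<y eq with m≤n⇒∃[o]m+o≡n s<t | m≤n⇒∃[o]m+o≡n x<y
... | u , refl | v , refl = m+1+n≢m (t′ * x + s * y′) (trans (sym expand) eq)
  where
  t′ = suc s + u
  y′ = suc x + v
  expand : s * x + t′ * y′ ≡ t′ * x + s * y′ + suc (u + v + u * v)
  expand = solve 4 (λ s x u v → s :* x :+ ((con 1 :+ s) :+ u) :* ((con 1 :+ x) :+ v)
                      := ((con 1 :+ s) :+ u) :* x :+ s :* ((con 1 :+ x) :+ v) :+ (con 1 :+ (u :+ v :+ u :* v)))
                   refl s x u v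

cross-product-cancel : ∀ s t x y → s * x + t * y ≡ t * x + s * y → s ≡ t ⊎ x ≡ y
cross-product-cancel s t x y eq with <-cmp s t | <-cmp x y
... | tri≈ _ s≡t _ | _            = inj₁ s≡t
... | _            | tri≈ _ x≡y _ = inj₂ x≡y
... | tri< s<t _ _ | tri< x<y _ _ = ⊥-elim (cross-product-< s<t x<y eq)
... | tri< s<t _ _ | tri> _ _ y<x =
  ⊥-elim (cross-product-< s<t y<x (trans (+-comm (s * y) (t * x)) (trans (sym eq) (+-comm (s * x) (t * y)))))
... | tri> _ _ t<s | tri< x<y _ _ = ⊥-elim (cross-product-< t<s x<y (sym eq))
... | tri> _ _ t<s | tri> _ _ y<x =
  ⊥-elim (cross-product-< t<s y<x (trans (+-comm (t * y) (s * x)) (trans eq (+-comm (t * x) (s * y)))))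

lines-meet-once : ∀ {s x c s′ c′ x′} → s * x + c ≡ s′ * x + c′ → s * x′ + c ≡ s′ * x′ + c′ →
                  x ≡ x′ ⊎ (s ≡ s′ × c ≡ c′)
lines-meet-once {s} {x} {c} {s′} {c′} {x′} e e′ with cross-product-cancel s s′ x x′ swapped
  where
  swapped : s * x + s′ * x′ ≡ s′ * x + s * x′
  swapped = +-cancelʳ-≡ (c + c′) _ _ (begin
    s * x + s′ * x′ + (c + c′)    ≡⟨ regroup (s * x) (s′ * x′) c c′ ⟩
    (s * x + c) + (s′ * x′ + c′)  ≡⟨ cong₂ _+_ e (sym e′) ⟩
    (s′ * x + c′) + (s * x′ + c)  ≡⟨ regroup (s′ * x) (s * x′) c′ c ⟨
    s′ * x + s * x′ + (c′ + c)    ≡⟨ cong (s′ * x + s * x′ +_) (+-comm c′ c) ⟩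
    s′ * x + s * x′ + (c + c′)    ∎)
    where
    open ≡-Reasoning
    regroup : ∀ p q r t → p + q + (r + t) ≡ (p + r) + (q + t)
    regroup = solve 4 (λ p q r t → p :+ q :+ (r :+ t) := (p :+ r) :+ (q :+ t)) refl
... | inj₁ refl = inj₂ (refl , +-cancelˡ-≡ (s * x) c c′ e)
... | inj₂ x≡x′ = inj₁ x≡x′

module _ {A : Set} (_≟_ : DecidableEquality A) where

  selected : List A → List Bool → A → Bool
  selected (e ∷ es) (b ∷ bs) f = (b ∧ ⌊ e ≟ f ⌋) ∨ selected es bs f
  selected _        _        _ = false

  selected-∈ : ∀ {es bs f} → T (selected es bs f) → f ∈ es
  selected-∈ {e ∷ es} {b ∷ bs} {f} h with to T-∨ h
  ... | inj₁ h₁ = here (sym (toWitness {a? = e ≟ f} (proj₂ (to (T-∧ {b}) h₁))))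
  ... | inj₂ h₂ = there (selected-∈ h₂)

  selected-head : ∀ {e es b bs} → e ∉ es → selected (e ∷ es) (b ∷ bs) e ≡ b
  selected-head {e} {es} {b} {bs} e∉es with e ≟ e | selected es bs e in eq
  ... | no e≢e | _     = ⊥-elim (e≢e refl)
  ... | yes _  | true  = ⊥-elim (e∉es (selected-∈ (subst T (sym eq) _)))
  ... | yes _  | false = trans (∨-identityʳ (b ∧ true)) (∧-identityʳ b)

  selected-tail : ∀ {e es b bs f} → e ≢ f → selected (e ∷ es) (b ∷ bs) f ≡ selected es bs f
  selected-tail {e} {es} {b} {bs} {f} e≢f with e ≟ f
  ... | yes e≡f = ⊥-elim (e≢f e≡f)
  ... | no _    = cong (_∨ selected es bs f) (∧-zeroʳ b)

  selected-injective : ∀ {es bs bs′} → Unique es → length bs ≡ length bs′ → length bs ≤ length es →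
                       (∀ {f} → f ∈ es → selected es bs f ≡ selected es bs′ f) → bs ≡ bs′
  selected-injective {_}      {[]}     {[]}      _         _   _         _     = refl
  selected-injective {[]}     {_ ∷ _}  {_}       _         _   ()        _
  selected-injective {e ∷ es} {b ∷ bs} {b′ ∷ bs′} (e∉ ∷ u) len (s≤s le) agree =
    cong₂ _∷_ (trans (sym (selected-head {bs = bs} e∉es))
                     (trans (agree (here refl)) (selected-head {bs = bs′} e∉es)))
              (selected-injective u (suc-injective len) le λ f∈ →
                 trans (sym (selected-tail {es = es} {b} {bs} (All.lookup e∉ f∈)))
                       (trans (agree (there f∈)) (selected-tail {es = es} {b′} {bs′} (All.lookup e∉ f∈))))
    where
    e∉es : e ∉ es
    e∉es e∈ = All.lookup e∉ e∈ refl

-- Vertices below `points` are the points (x, y), x < a, y < 2a²; the a³ vertices from `points` on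
-- are the lines y = s x + c, s < a, c < a².
module AffinePlane (a : ℕ) where

  ordinates : ℕ
  ordinates = a * a + a * a

  points : ℕ
  points = ordinates * a

  order : ℕ
  order = points + a * a * a

  point : ℕ → ℕ → ℕ
  point x y = x + y * a

  line : ℕ → ℕ → ℕ
  line s c = points + (s + c * a)

  record Incident (p q : ℕ) : Set where
    constructor incident
    field
      {slope abscissa intercept} : ℕ
      slope<a     : slope < a
      abscissa<a  : abscissa < a
      intercept<  : intercept < a * a
      point≡      : p ≡ point abscissa (slope * abscissa + intercept)
      line≡       : q ≡ line slope intercept

  Triple : Set
  Triple = Fin a × Fin a × Fin (a * a)

  incidence : Triple → ℕ × ℕ
  incidence (s , x , c) = point (toℕ x) (toℕ s * toℕ x + toℕ c) , line (toℕ s) (toℕ c)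

  triples : List Triple
  triples = cartesianProduct (allFin a) (cartesianProduct (allFin a) (allFin (a * a)))

  incidences : List (ℕ × ℕ)
  incidences = map incidence triples

  private
    line-injective : ∀ {s c s′ c′} → s < a → s′ < a → line s c ≡ line s′ c′ → s ≡ s′ × c ≡ c′
    line-injective s<a s′<a eq = radix-injective s<a s′<a (+-cancelˡ-≡ points _ _ eq)

  point<points : ∀ {p q} → Incident p q → p < points
  point<points (incident s<a x<a c< refl _) =
    radix-bound x<a (+-mono-≤-< (*-mono-≤ (<⇒≤ s<a) (<⇒≤ x<a)) c<)

  points≤line : ∀ {p q} → Incident p q → points ≤ q
  points≤line (incident _ _ _ _ refl) = m≤m+n points _

  line<order : ∀ {p q} → Incident p q → q < order
  line<order (incident s<a _ c< _ refl) = +-monoʳ-< points (radix-bound s<a c<)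

  linear : ∀ {p p′ q q′} → Incident p q → Incident p′ q → Incident p q′ → Incident p′ q′ →
           p ≡ p′ ⊎ q ≡ q′
  linear (incident {s₁} {x₁} {c₁} s₁<a x₁<a _ refl refl)
         (incident {s₂} {x₂} {c₂} s₂<a x₂<a _ p′≡ q≡)
         (incident {s₃} {x₃} {c₃} s₃<a x₃<a _ p≡ q′≡)
         (incident {s₄} {x₄} {c₄} s₄<a x₄<a _ refl refl)
    with line-injective {c = c₁} {c′ = c₂} s₁<a s₂<a q≡ | line-injective {c = c₄} {c′ = c₃} s₄<a s₃<a q′≡
  ... | refl , refl | refl , refl
    with radix-injective {y = s₁ * x₁ + c₁} {y′ = s₃ * x₃ + c₃} x₁<a x₃<a p≡
       | radix-injective {y = s₃ * x₄ + c₃} {y′ = s₁ * x₂ + c₁} x₄<a x₂<a p′≡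
  ... | refl , y₁≡ | refl , y₂≡ with lines-meet-once {s₁} {x₁} {c₁} {s₃} {c₃} {x₂} y₁≡ (sym y₂≡)
  ...   | inj₁ refl          = inj₁ (cong (point x₁) y₁≡)
  ...   | inj₂ (refl , refl) = inj₂ refl

  isPoint : ℕ → Bool
  isPoint p = p <ᵇ points

  incident-sides : ∀ {p q} → Incident p q → isPoint p ≡ true × isPoint q ≡ false
  incident-sides {p} {q} i = to T-≡ (<⇒<ᵇ (point<points i)) ,
                             to T-not-≡ (¬T⇒T-not (λ t → <⇒≱ (<ᵇ⇒< q points t) (points≤line i)))

  open Levi isPoint Incident incident-sides linear public

  ∈-incidences⁻ : ∀ {p q} → (p , q) ∈ incidences → Incident p q
  ∈-incidences⁻ mem with ∈-map⁻ incidence mem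
  ... | (s , x , c) , _ , eq = incident (toℕ<n s) (toℕ<n x) (toℕ<n c) (,-injectiveˡ eq) (,-injectiveʳ eq)

  incidence-injective : ∀ {t t′} → incidence t ≡ incidence t′ → t ≡ t′
  incidence-injective {s , x , c} {s′ , x′ , c′} eq
    with radix-injective {y = toℕ c} {y′ = toℕ c′} (toℕ<n s) (toℕ<n s′)
                         (+-cancelˡ-≡ points _ _ (,-injectiveʳ eq))
       | radix-injective {y = toℕ s * toℕ x + toℕ c} {y′ = toℕ s′ * toℕ x′ + toℕ c′} (toℕ<n x) (toℕ<n x′)
                         (,-injectiveˡ eq)
  ... | s≡ , c≡ | x≡ , _ = cong₂ _,_ (toℕ-injective s≡) (cong₂ _,_ (toℕ-injective x≡) (toℕ-injective c≡))

  incidences-unique : Unique incidences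
  incidences-unique = Unique.map⁺ incidence-injective (Unique.cartesianProduct⁺ (Unique.allFin⁺ a)
    (Unique.cartesianProduct⁺ (Unique.allFin⁺ a) (Unique.allFin⁺ (a * a))))

  length-incidences : length incidences ≡ a * (a * (a * a))
  length-incidences = begin
    length (map incidence triples)  ≡⟨ length-map incidence triples ⟩
    length triples                  ≡⟨ length-cartesianProductWith _,_ (allFin a) _ ⟩
    length (allFin a) * length (cartesianProduct (allFin a) (allFin (a * a)))
      ≡⟨ cong₂ _*_ (length-tabulate {n = a} id) (length-cartesianProductWith _,_ (allFin a) (allFin (a * a))) ⟩
    a * (length (allFin a) * length (allFin (a * a)))
      ≡⟨ cong (a *_) (cong₂ _*_ (length-tabulate {n = a} id) (length-tabulate {n = a * a} id)) ⟩
    a * (a * (a * a))               ∎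
    where open ≡-Reasoning

  _≟²_ : DecidableEquality (ℕ × ℕ)
  _≟²_ = ≡-dec ℕ._≟_ ℕ._≟_

  chosen : List Bool → ℕ × ℕ → Bool
  chosen = selected _≟²_ incidences

  gadget : List Bool → ℕ → ℕ → Bool
  gadget bs p q = chosen bs (p , q) ∨ chosen bs (q , p)

  private
    chosen-incident : ∀ {bs p q} → T (chosen bs (p , q)) → Incident p q
    chosen-incident {bs} = ∈-incidences⁻ ∘ selected-∈ _≟²_ {incidences} {bs}

    unchosen : ∀ {bs p q} → ¬ Incident p q → chosen bs (p , q) ≡ false
    unchosen {bs} ¬i = to T-not-≡ (¬T⇒T-not (¬i ∘ chosen-incident {bs}))

  gadget-sym : ∀ bs p q → gadget bs p q ≡ gadget bs q p
  gadget-sym bs p q = ∨-comm (chosen bs (p , q)) (chosen bs (q , p))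

  gadget-irrefl : ∀ bs p → gadget bs p p ≡ false
  gadget-irrefl bs p = cong (λ b → b ∨ b) (unchosen {bs} (λ i → <⇒≱ (point<points i) (points≤line i)))

  gadget⊆levi : ∀ {bs p q} → T (gadget bs p q) → Levi p q
  gadget⊆levi {bs} {p} {q} h with to (T-∨ {chosen bs (p , q)}) h
  ... | inj₁ pq = inj₁ (chosen-incident {bs} pq)
  ... | inj₂ qp = inj₂ (chosen-incident {bs} qp)

  gadget-incidence : ∀ {bs p q} → (p , q) ∈ incidences → gadget bs p q ≡ chosen bs (p , q)
  gadget-incidence {bs} mem =
    trans (cong (chosen bs _ ∨_) (unchosen {bs} λ i → <⇒≱ (point<points i) (points≤line (∈-incidences⁻ mem))))
          (∨-identityʳ _)

  gadget-injective : ∀ {bs bs′} → length bs ≡ length bs′ → length bs ≤ length incidences →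
                     (∀ {p q} → p < order → q < order → gadget bs p q ≡ gadget bs′ p q) → bs ≡ bs′
  gadget-injective {bs} {bs′} len le agree =
    selected-injective _≟²_ incidences-unique len le λ {(p , q)} mem →
      let i = ∈-incidences⁻ mem
      in trans (sym (gadget-incidence {bs} mem))
               (trans (agree (<-≤-trans (point<points i) (m≤m+n points _)) (line<order i))
                      (gadget-incidence {bs′} mem))

  gadget-triangleFree : ∀ bs → TriangleFree (λ p q → T (gadget bs p q))
  gadget-triangleFree bs {p} {q} {r} = triangleFree-⊆ (gadget⊆levi {bs}) levi-triangleFree {p} {q} {r}

  gadget-C4Free : ∀ bs → C4Free (λ p q → T (gadget bs p q))
  gadget-C4Free bs {p} {q} {r} {s} = C4Free-⊆ (gadget⊆levi {bs}) levi-C4Free {p} {q} {r} {s}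

-- Stars in graphs of girth at least five

T-injective : ∀ {x y} → (T x → T y) → (T y → T x) → x ≡ y
T-injective {true}  {true}  _ _ = refl
T-injective {true}  {false} f _ = ⊥-elim (f _)
T-injective {false} {true}  _ g = ⊥-elim (g _)
T-injective {false} {false} _ _ = refl

module _ {A : Set} (p : A → Bool) where

  head-filterᵇ : ∀ xs → (head (filterᵇ p xs) ≡ nothing × (∀ {x} → x ∈ xs → ¬ T (p x)))
                      ⊎ Σ A λ x → head (filterᵇ p xs) ≡ just x × x ∈ xs × T (p x)
  head-filterᵇ []       = inj₁ (refl , λ ())
  head-filterᵇ (x ∷ xs) with p x in px
  ... | true  = inj₂ (x , refl , here refl , subst T (sym px) _)
  ... | false with head-filterᵇ xs
  ...   | inj₁ (eq , none)        = inj₁ (eq , λ { (here refl) → subst T px ; (there x∈) → none x∈ })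
  ...   | inj₂ (y , eq , y∈ , py) = inj₂ (y , eq , there y∈ , py)

-- Defaulting to y is harmless: when y ∉ ts the default cannot be mistaken for a vertex of ts.
link : ∀ {n} → Graph n → List (Fin n) → Fin n → Fin n
link G ts y = fromMaybe y (head (filterᵇ (adj G y) ts))

record Star {n} (G : Graph n) (v : Fin n) (S : List (Fin n)) : Set where
  field
    girth : T (girth≥5 G)
    spoke : ∀ {x} → x ∈ S → Adj G v x

  hub∉spokes : v ∉ S
  hub∉spokes v∈S = subst T (adj-irrefl G v) (spoke v∈S)

  spokes-independent : ∀ {x y} → x ∈ S → y ∈ S → ¬ Adj G x y
  spokes-independent x∈S y∈S xy =
    girth≥5⇒triangleFree G girth (spoke x∈S) xy (subst T (adj-sym G v _) (spoke y∈S))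

  unique-neighbour : ∀ {y x x′} → y ∉ v ∷ S → x ∈ v ∷ S → x′ ∈ v ∷ S →
                     Adj G y x → Adj G y x′ → x ≡ x′
  unique-neighbour _  (here refl) (here refl) _  _   = refl
  unique-neighbour _  (here refl) (there x′∈) yx yx′ =
    ⊥-elim (girth≥5⇒triangleFree G girth yx (spoke x′∈) (subst T (adj-sym G _ _) yx′))
  unique-neighbour _  (there x∈)  (here refl) yx yx′ =
    ⊥-elim (girth≥5⇒triangleFree G girth yx′ (spoke x∈) (subst T (adj-sym G _ _) yx))
  unique-neighbour {y} {x} {x′} y∉ (there x∈) (there x′∈) yx yx′ with x ≟ x′
  ... | yes x≡x′ = x≡x′
  ... | no x≢x′  = ⊥-elim (girth≥5⇒C4Free G girth yx (subst T (adj-sym G v x) (spoke x∈)) (spoke x′∈)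
                             (subst T (adj-sym G y x′) yx′) (λ { refl → y∉ (here refl) }) x≢x′)

  link-of-neighbour : ∀ {x y} → x ∈ v ∷ S → y ∉ v ∷ S → Adj G x y → link G (v ∷ S) y ≡ x
  link-of-neighbour {x} {y} x∈ y∉ xy with head-filterᵇ (adj G y) (v ∷ S)
  ... | inj₁ (_ , none)         = ⊥-elim (none x∈ (subst T (adj-sym G x y) xy))
  ... | inj₂ (z , eq , z∈ , yz) =
    trans (cong (fromMaybe y) eq) (unique-neighbour y∉ z∈ x∈ yz (subst T (adj-sym G x y) xy))

  link-adjacent : ∀ {x y} → x ∈ v ∷ S → y ∉ v ∷ S → link G (v ∷ S) y ≡ x → Adj G x y
  link-adjacent {x} {y} x∈ y∉ link≡x with head-filterᵇ (adj G y) (v ∷ S)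
  ... | inj₁ (eq , _)          =
    ⊥-elim (y∉ (subst (_∈ v ∷ S) (trans (sym link≡x) (cong (fromMaybe y) eq)) x∈))
  ... | inj₂ (z , eq , _ , yz) =
    subst T (adj-sym G y x) (subst (Adj G y) (trans (sym (cong (fromMaybe y) eq)) link≡x) yz)

module _ {n} {G G′ : Graph n} {v S} (st : Star G v S) (st′ : Star G′ v S) where

  private
    module st = Star st
    module st′ = Star st′

  star-agree : ∀ {x y} → x ∈ v ∷ S → y ∈ v ∷ S → adj G x y ≡ adj G′ x y
  star-agree (here refl) (here refl) = trans (adj-irrefl G v) (sym (adj-irrefl G′ v))
  star-agree (here refl) (there y∈)  = T-injective (λ _ → st′.spoke y∈) (λ _ → st.spoke y∈)
  star-agree {x} (there x∈) (here refl) = T-injective (λ _ → subst T (adj-sym G′ v x) (st′.spoke x∈))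
                                                      (λ _ → subst T (adj-sym G v x) (st.spoke x∈))
  star-agree (there x∈) (there y∈)  = T-injective (⊥-elim ∘ st.spokes-independent x∈ y∈)
                                                  (⊥-elim ∘ st′.spokes-independent x∈ y∈)

  link-agree : ∀ {x y} → x ∈ v ∷ S → y ∉ v ∷ S → link G (v ∷ S) y ≡ link G′ (v ∷ S) y →
               adj G x y ≡ adj G′ x y
  link-agree x∈ y∉ same-link = T-injective
    (st′.link-adjacent x∈ y∉ ∘ trans (sym same-link) ∘ st.link-of-neighbour x∈ y∉)
    (st.link-adjacent x∈ y∉ ∘ trans same-link ∘ st′.link-of-neighbour x∈ y∉)

  open DecMembership (_≟_ {n}) using (_∈?_)

  reconstruct : (∀ y → link G (v ∷ S) y ≡ link G′ (v ∷ S) y) →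
                (∀ {x y} → x ∉ v ∷ S → y ∉ v ∷ S → adj G x y ≡ adj G′ x y) → G ≡ G′
  reconstruct same-links same-rest = adj-ext agree
    where
    agree : ∀ x y → adj G x y ≡ adj G′ x y
    agree x y with x ∈? v ∷ S | y ∈? v ∷ S
    ... | yes x∈ | yes y∈ = star-agree x∈ y∈
    ... | yes x∈ | no  y∉ = link-agree x∈ y∉ (same-links y)
    ... | no  x∉ | yes y∈ = trans (adj-sym G x y) (trans (link-agree y∈ x∉ (same-links x)) (adj-sym G′ y x))
    ... | no  x∉ | no  y∉ = same-rest x∉ y∉

module _ {A : Set} where

  lookup-++-∈ˡ : ∀ (xs : List A) {ys} (k : Fin (length (xs ++ ys))) → toℕ k < length xs →
                 lookup (xs ++ ys) k ∈ xs
  lookup-++-∈ˡ (x ∷ xs) zero    _      = here refl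
  lookup-++-∈ˡ (x ∷ xs) (suc k) (s≤s k<) = there (lookup-++-∈ˡ xs k k<)

module _ {n : ℕ} (ts : List (Fin n)) where

  open DecMembership (_≟_ {n}) using (_∈?_; _∉?_)

  complement : List (Fin n)
  complement = filter (_∉? ts) (allFin n)

  arrangement : List (Fin n)
  arrangement = ts ++ complement

  arrangement-complete : ∀ x → x ∈ arrangement
  arrangement-complete x with x ∈? ts
  ... | yes x∈ = ∈-++⁺ˡ x∈
  ... | no  x∉ = ∈-++⁺ʳ ts (∈-filter⁺ (_∉? ts) (∈-allFin x) x∉)

  arrangement-unique : Unique ts → Unique arrangement
  arrangement-unique u = Unique.++⁺ u (Unique.filter⁺ (_∉? ts) (Unique.allFin⁺ n))
    λ (x∈ts , x∈c) → proj₂ (∈-filter⁻ (_∉? ts) {xs = allFin n} x∈c) x∈ts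

  n≤length-arrangement : n ≤ length arrangement
  n≤length-arrangement = subst (_≤ length arrangement) (length-tabulate id)
    (length-≤-injection (Unique.allFin⁺ n) id (λ {x} _ → arrangement-complete x) (λ _ _ eq → eq))

  length-arrangement≤n : Unique ts → length arrangement ≤ n
  length-arrangement≤n u = subst (length arrangement ≤_) (length-tabulate id)
    (length-≤-injection (arrangement-unique u) id (λ {x} _ → ∈-allFin x) (λ _ _ eq → eq))

  relabel : Fin n → Fin n
  relabel i = lookup arrangement (inject≤ i n≤length-arrangement)

  relabel-injective : Unique ts → ∀ {i j} → relabel i ≡ relabel j → i ≡ j
  relabel-injective u {i} {j} eq = inject≤-injective _ _ i j (lookup-injective (arrangement-unique u) eq)

  relabel-onto : Unique ts → ∀ {x} → x ∉ ts → Σ (Fin n) λ i → length ts ≤ toℕ i × relabel i ≡ x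
  relabel-onto u {x} x∉ = i , length≤i , relabel-i
    where
    x∈ = arrangement-complete x
    k<n : toℕ (index x∈) < n
    k<n = <-≤-trans (toℕ<n (index x∈)) (length-arrangement≤n u)
    i = fromℕ< k<n
    relabel-i : relabel i ≡ x
    relabel-i = trans (cong (lookup arrangement) (toℕ-injective (trans (toℕ-inject≤ i _) (toℕ-fromℕ< k<n))))
                      (sym (lookup-index x∈))
    length≤i : length ts ≤ toℕ i
    length≤i = ≮⇒≥ λ i< → x∉ (subst (_∈ ts) relabel-i
                 (lookup-++-∈ˡ ts _ (subst (_< length ts) (sym (toℕ-inject≤ i _)) i<)))

-- Planting the gadget

bits : ℕ → ℕ → List Bool
bits zero    x = []
bits (suc ℓ) x with x <? 2 ^ ℓ
... | yes _ = false ∷ bits ℓ x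
... | no  _ = true  ∷ bits ℓ (x ∸ 2 ^ ℓ)

length-bits : ∀ ℓ x → length (bits ℓ x) ≡ ℓ
length-bits zero    x = refl
length-bits (suc ℓ) x with x <? 2 ^ ℓ
... | yes _ = cong suc (length-bits ℓ x)
... | no  _ = cong suc (length-bits ℓ (x ∸ 2 ^ ℓ))

bits-injective : ∀ ℓ {x y} → x < 2 ^ ℓ → y < 2 ^ ℓ → bits ℓ x ≡ bits ℓ y → x ≡ y
bits-injective zero    {zero} {zero} _ _ _ = refl
bits-injective zero    {suc _} (s≤s ()) _ _
bits-injective zero    {zero} {suc _} _ (s≤s ()) _
bits-injective (suc ℓ) {x} {y} x< y< eq with x <? 2 ^ ℓ | y <? 2 ^ ℓ
... | yes x<ℓ | yes y<ℓ = bits-injective ℓ x<ℓ y<ℓ (∷-injectiveʳ eq)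
... | yes _   | no  _   with () ← ∷-injectiveˡ eq
... | no  _   | yes _   with () ← ∷-injectiveˡ eq
... | no x≮ℓ  | no y≮ℓ  = ∸-cancelʳ-≡ (≮⇒≥ x≮ℓ) (≮⇒≥ y≮ℓ)
    (bits-injective ℓ (top-bit-removed x< (≮⇒≥ x≮ℓ)) (top-bit-removed y< (≮⇒≥ y≮ℓ)) (∷-injectiveʳ eq))
  where
  top-bit-removed : ∀ {z} → z < 2 ^ suc ℓ → 2 ^ ℓ ≤ z → z ∸ 2 ^ ℓ < 2 ^ ℓ
  top-bit-removed {z} z< ≤z =
    subst (z ∸ 2 ^ ℓ <_) (trans (m+n∸m≡n (2 ^ ℓ) (2 ^ ℓ + 0)) (+-identityʳ (2 ^ ℓ))) (∸-monoˡ-< z< ≤z)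

module _ {A : Set} where

  ++-injective : ∀ (xs xs′ : List A) {ys ys′} → length xs ≡ length xs′ → xs ++ ys ≡ xs′ ++ ys′ →
                 xs ≡ xs′ × ys ≡ ys′
  ++-injective []       []         _   eq = refl , eq
  ++-injective (x ∷ xs) (x′ ∷ xs′) len eq =
    let x≡x′ , rest = ∷-injective eq ; xs≡xs′ , ys≡ys′ = ++-injective xs xs′ (suc-injective len) rest
    in cong₂ _∷_ x≡x′ xs≡xs′ , ys≡ys′

  ∈-take⁻ : ∀ k {xs : List A} {x} → x ∈ take k xs → x ∈ xs
  ∈-take⁻ (suc k) {_ ∷ _} (here refl) = here refl
  ∈-take⁻ (suc k) {_ ∷ _} (there x∈)  = there (∈-take⁻ k x∈)

module _ {A B : Set} (f : A → List B) {k : ℕ} (length-f : ∀ x → length (f x) ≡ k) where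

  length-concatMap : ∀ xs → length (concatMap f xs) ≡ length xs * k
  length-concatMap []       = refl
  length-concatMap (x ∷ xs) = trans (length-++ (f x)) (cong₂ _+_ (length-f x) (length-concatMap xs))

  concatMap-injective : (∀ {x y} → f x ≡ f y → x ≡ y) →
                        ∀ {xs ys} → length xs ≡ length ys → concatMap f xs ≡ concatMap f ys → xs ≡ ys
  concatMap-injective f-inj {[]}     {[]}     _   _  = refl
  concatMap-injective f-inj {x ∷ xs} {y ∷ ys} len eq =
    let fx≡fy , rest = ++-injective (f x) (f y) (trans (length-f x) (sym (length-f y))) eq
    in cong₂ _∷_ (f-inj fx≡fy) (concatMap-injective f-inj (suc-injective len) rest)

module _ {A B : Set} {f g : A → B} where

  map-≡⇒≡ : ∀ {xs} → map f xs ≡ map g xs → ∀ {x} → x ∈ xs → f x ≡ g x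
  map-≡⇒≡ {_ ∷ _}  eq (here refl) = proj₁ (∷-injective eq)
  map-≡⇒≡ {_ ∷ xs} eq (there x∈)  = map-≡⇒≡ (proj₂ (∷-injective eq)) x∈

module Planting (n d a ℓ k : ℕ) where

  open AffinePlane a

  isHub : Graph n → Fin n → Bool
  isHub G i = d ≤ᵇ deg G i

  spokes : Graph n → Fin n → List (Fin n)
  spokes G v = take (order ∸ 1) (neighbours G v)

  star : Graph n → List (Fin n)
  star G = maybe′ (λ v → v ∷ spokes G v) [] (head (filterᵇ (isHub G) (allFin n)))

  encode : Fin n → List Bool
  encode = bits ℓ ∘ toℕ

  code : Graph n → Vec Bool k → List Bool
  code G b = concatMap encode (star G ++ map (link G (star G)) (allFin n)) ++ toList b

  low : Fin n → Bool
  low i = toℕ i <ᵇ order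

  gadgetPart : Graph n → Vec Bool k → Fin n → Fin n → Bool
  gadgetPart G b i j = gadget (code G b) (toℕ i) (toℕ j)

  restPart : Graph n → Fin n → Fin n → Bool
  restPart G i j = adj G (relabel (star G) i) (relabel (star G) j)

  module Parts (G : Graph n) (b : Vec Bool k) = DisjointUnion low (gadgetPart G b) (restPart G)

  planted : Graph n → Vec Bool k → Graph n
  planted G b = fromAdj (Parts.union G b)

  adj-planted : ∀ G b i j → adj (planted G b) i j ≡ Parts.union G b i j
  adj-planted G b = adj-fromAdj (Parts.union G b)
    (Parts.union-sym G b (λ i j → gadget-sym (code G b) (toℕ i) (toℕ j)) (λ i j → adj-sym G _ _))
    (Parts.union-irrefl G b (λ i → gadget-irrefl (code G b) (toℕ i)) (λ i → adj-irrefl G _))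

  record Hub (G : Graph n) : Set where
    field
      hub        : Fin n
      star≡      : star G ≡ hub ∷ spokes G hub
      hub-degree : d ≤ deg G hub

  hub-exists : ∀ G → T (maxDegAtLeast G d) → Hub G
  hub-exists G maxdeg with head-filterᵇ (isHub G) (allFin n)
  ... | inj₁ (_ , none) =
    let _ , v∈ , hub-v = find (any⁻ (isHub G) (allFin n) maxdeg) in ⊥-elim (none v∈ hub-v)
  ... | inj₂ (v , eq , _ , hub-v) = record
    { hub        = v
    ; star≡      = cong (maybe′ (λ v → v ∷ spokes G v) []) eq
    ; hub-degree = ≤ᵇ⇒≤ d (deg G v) hub-v
    }

  module Dense (order>0 : 0 < order) (room : order ≤ suc d)
               {G : Graph n} (girth : T (girth≥5 G)) (h : Hub G) where

    open Hub h

    star-shape : Star G hub (spokes G hub)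
    star-shape = record
      { girth = girth
      ; spoke = λ {x} x∈ → proj₂ (∈-filter⁻ (T? ∘ adj G hub) {xs = allFin n} (∈-take⁻ (order ∸ 1) x∈))
      }

    star-unique : Unique (star G)
    star-unique = subst Unique (sym star≡)
      (¬Any⇒All¬ _ (Star.hub∉spokes star-shape)
         ∷ Unique.take⁺ (order ∸ 1) (Unique.filter⁺ (T? ∘ adj G hub) (Unique.allFin⁺ n)))

    length-star : length (star G) ≡ order
    length-star = begin
      length (star G)                                ≡⟨ cong length star≡ ⟩
      suc (length (spokes G hub))                    ≡⟨ cong suc (length-take (order ∸ 1) _) ⟩
      suc ((order ∸ 1) ⊓ length (neighbours G hub))  ≡⟨ cong suc (m≤n⇒m⊓n≡m enough-neighbours) ⟩
      suc (order ∸ 1)                                ≡⟨ m+[n∸m]≡n order>0 ⟩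
      order                                          ∎
      where
      open ≡-Reasoning
      enough-neighbours : order ∸ 1 ≤ length (neighbours G hub)
      enough-neighbours = ≤-trans (∸-monoˡ-≤ 1 room) (subst (d ≤_) (deg≡length-neighbours G hub) hub-degree)

    planted-girth : ∀ b → T (girth≥5 (planted G b))
    planted-girth b = triangleFree∧C4Free⇒girth≥5 (planted G b)
      (λ {i j l} → triangleFree-⊆ to-union (Parts.union-triangleFree G b gadget-tf rest-tf) {i} {j} {l})
      (λ {i j l r} → C4Free-⊆ to-union (Parts.union-C4Free G b gadget-c4 rest-c4) {i} {j} {l} {r})
      where
      to-union : ∀ {i j} → Adj (planted G b) i j → T (Parts.union G b i j)
      to-union {i} {j} = subst T (adj-planted G b i j)
      gadget-tf : TriangleFree (λ i j → T (gadgetPart G b i j))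
      gadget-tf = gadget-triangleFree (code G b)
      rest-tf : TriangleFree (λ i j → T (restPart G i j))
      rest-tf = girth≥5⇒triangleFree G girth
      gadget-c4 : C4Free (λ i j → T (gadgetPart G b i j))
      gadget-c4 {i} {j} {l} {r} = C4Free-comap toℕ toℕ-injective (gadget-C4Free (code G b)) {i} {j} {l} {r}
      rest-c4 : C4Free (λ i j → T (restPart G i j))
      rest-c4 {i} {j} {l} {r} =
        C4Free-comap (relabel (star G)) (relabel-injective (star G) star-unique) (girth≥5⇒C4Free G girth)
                     {i} {j} {l} {r}

  module Injectivity (order>0 : 0 < order) (room : order ≤ suc d) (names : n ≤ 2 ^ ℓ)
                     (fits : (order + n) * ℓ + k ≤ a * (a * (a * a))) where

    length-encode : ∀ x → length (encode x) ≡ ℓ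
    length-encode x = length-bits ℓ (toℕ x)

    encode-injective : ∀ {x y} → encode x ≡ encode y → x ≡ y
    encode-injective {x} {y} eq =
      toℕ-injective (bits-injective ℓ (<-≤-trans (toℕ<n x) names) (<-≤-trans (toℕ<n y) names) eq)

    word : Graph n → List (Fin n)
    word G = star G ++ map (link G (star G)) (allFin n)

    length-word : ∀ {G} → length (star G) ≡ order → length (word G) ≡ order + n
    length-word {G} length-star = begin
      length (star G ++ map (link G (star G)) (allFin n))
        ≡⟨ length-++ (star G) ⟩
      length (star G) + length (map (link G (star G)) (allFin n))
        ≡⟨ cong₂ _+_ length-star (length-map _ (allFin n)) ⟩
      order + length (allFin n)  ≡⟨ cong (order +_) (length-tabulate id) ⟩
      order + n                  ∎
      where open ≡-Reasoning

    length-encoding : ∀ {G} → length (star G) ≡ order → length (concatMap encode (word G)) ≡ (order + n) * ℓ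
    length-encoding {G} length-star =
      trans (length-concatMap encode length-encode (word G)) (cong (_* ℓ) (length-word length-star))

    length-code : ∀ {G} b → length (star G) ≡ order → length (code G b) ≡ (order + n) * ℓ + k
    length-code {G} b length-star =
      trans (length-++ (concatMap encode (word G))) (cong₂ _+_ (length-encoding length-star) (Vecₚ.length-toList b))

    decode : ∀ {G G′ b b′} → length (star G) ≡ order → length (star G′) ≡ order →
             code G b ≡ code G′ b′ →
             star G ≡ star G′ × (∀ y → link G (star G) y ≡ link G′ (star G′) y) × b ≡ b′
    decode {G} {G′} {b} {b′} ls ls′ eq =
      let same-encoding , same-payload =
            ++-injective (concatMap encode (word G)) _ (trans (length-encoding ls) (sym (length-encoding ls′))) eq
          same-word = concatMap-injective encode length-encode encode-injective
                        (trans (length-word ls) (sym (length-word ls′))) same-encoding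
          same-star , same-links = ++-injective (star G) (star G′) (trans ls (sym ls′)) same-word
      in same-star , (λ y → map-≡⇒≡ same-links (∈-allFin y)) ,
         trans (sym (Vecₚ.cast-is-id refl b)) (Vecₚ.toList-injective refl b b′ same-payload)

    module _ {G G′ : Graph n} {b b′} (girth : T (girth≥5 G)) (h : Hub G)
             (girth′ : T (girth≥5 G′)) (h′ : Hub G′) (same : planted G b ≡ planted G′ b′) where

      private
        module D = Dense order>0 room girth h
        module D′ = Dense order>0 room girth′ h′
        module P = Parts G b
        module P′ = Parts G′ b′

      same-union : ∀ i j → P.union i j ≡ P′.union i j
      same-union i j =
        trans (sym (adj-planted G b i j)) (trans (cong (λ H → adj H i j) same) (adj-planted G′ b′ i j))

      order≤n : order ≤ n
      order≤n = subst₂ _≤_ D.length-star (length-tabulate id)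
        (length-≤-injection D.star-unique id (λ {x} _ → ∈-allFin x) (λ _ _ eq → eq))

      same-gadget : ∀ {p q} → p < order → q < order → gadget (code G b) p q ≡ gadget (code G′ b′) p q
      same-gadget {p} {q} p< q< = begin
        gadget (code G b) p q
          ≡⟨ cong₂ (gadget (code G b)) (sym (toℕ-fromℕ< p<n)) (sym (toℕ-fromℕ< q<n)) ⟩
        gadgetPart G b i j                    ≡⟨ P.union-low low-i low-j ⟨
        P.union i j                           ≡⟨ same-union i j ⟩
        P′.union i j                          ≡⟨ P′.union-low low-i low-j ⟩
        gadgetPart G′ b′ i j
          ≡⟨ cong₂ (gadget (code G′ b′)) (toℕ-fromℕ< p<n) (toℕ-fromℕ< q<n) ⟩
        gadget (code G′ b′) p q               ∎
        where
        open ≡-Reasoning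
        p<n = <-≤-trans p< order≤n
        q<n = <-≤-trans q< order≤n
        i = fromℕ< p<n
        j = fromℕ< q<n
        low-i : T (low i)
        low-i = <⇒<ᵇ (subst (_< order) (sym (toℕ-fromℕ< p<n)) p<)
        low-j : T (low j)
        low-j = <⇒<ᵇ (subst (_< order) (sym (toℕ-fromℕ< q<n)) q<)

      same-code : code G b ≡ code G′ b′
      same-code = gadget-injective (trans (length-code b D.length-star) (sym (length-code b′ D′.length-star)))
                    (subst₂ _≤_ (sym (length-code b D.length-star)) (sym length-incidences) fits) same-gadget

      planted-injective : G ≡ G′ × b ≡ b′
      planted-injective = reconstruct D.star-shape shape′ same-links same-rest , same-bits
        where
        decoded = decode D.length-star D′.length-star same-code
        same-star = proj₁ decoded
        same-bits = proj₂ (proj₂ decoded)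
        v = Hub.hub h
        S = spokes G v
        star≡ : star G ≡ v ∷ S
        star≡ = Hub.star≡ h
        star′≡ : star G′ ≡ v ∷ S
        star′≡ = trans (sym same-star) star≡
        shape′ : Star G′ v S
        shape′ = let hub≡ , spokes≡ = ∷-injective (trans (sym (Hub.star≡ h′)) star′≡)
                 in subst₂ (Star G′) hub≡ spokes≡ D′.star-shape
        same-links : ∀ y → link G (v ∷ S) y ≡ link G′ (v ∷ S) y
        same-links y =
          subst₂ (λ t t′ → link G t y ≡ link G′ t′ y) star≡ star′≡ (proj₁ (proj₂ decoded) y)
        high : ∀ {i} → length (star G) ≤ toℕ i → ¬ T (low i)
        high {i} ≤i t = <⇒≱ (<ᵇ⇒< (toℕ i) order t) (subst (_≤ toℕ i) D.length-star ≤i)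
        same-rest : ∀ {x y} → x ∉ v ∷ S → y ∉ v ∷ S → adj G x y ≡ adj G′ x y
        same-rest {x} {y} x∉ y∉
          with relabel-onto (star G) D.star-unique (subst (x ∉_) (sym star≡) x∉)
             | relabel-onto (star G) D.star-unique (subst (y ∉_) (sym star≡) y∉)
        ... | i , ≤i , x≡ | j , ≤j , y≡ = begin
          adj G x y                                         ≡⟨ cong₂ (adj G) (sym x≡) (sym y≡) ⟩
          restPart G i j                                    ≡⟨ P.union-high (high ≤i) (high ≤j) ⟨
          P.union i j                                       ≡⟨ same-union i j ⟩
          P′.union i j                                      ≡⟨ P′.union-high (high ≤i) (high ≤j) ⟩
          restPart G′ i j
            ≡⟨ cong (λ t → adj G′ (relabel t i) (relabel t j)) same-star ⟨
          adj G′ (relabel (star G) i) (relabel (star G) j)  ≡⟨ cong₂ (adj G′) x≡ y≡ ⟩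
          adj G′ x y                                        ∎
          where open ≡-Reasoning

    private
      dense : ∀ {G} → G ∈ filterᵇ (λ G → girth≥5 G ∧ maxDegAtLeast G d) (allGraphs n) →
              T (girth≥5 G) × Hub G
      dense {G} G∈ =
        let girth , maxdeg = to T-∧ (proj₂ (∈-filter⁻ (T? ∘ λ G → girth≥5 G ∧ maxDegAtLeast G d) {xs = allGraphs n} G∈))
        in girth , hub-exists G maxdeg

    planted-count : 2 ^ k * countGirth5MaxDeg≥ n d ≤ countGirth5 n
    planted-count = subst (_≤ countGirth5 n)
      (trans (cong (countGirth5MaxDeg≥ n d *_) (length-allVecs k)) (*-comm _ (2 ^ k)))
      (length-*-≤-injection (Unique.filter⁺ _ (allGraphs-unique n)) (allVecs-unique k) planted
        (λ {G} G∈ _ → let girth , h = dense G∈ in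
           ∈-filter⁺ (T? ∘ girth≥5) (allGraphs-complete (planted G _)) (Dense.planted-girth order>0 room girth h _))
        (λ G∈ G′∈ _ _ same → let girth , h = dense G∈ ; girth′ , h′ = dense G′∈ in
           planted-injective girth h girth′ h′ same))

-- Choice of parameters

bracket : ∀ (f : ℕ → ℕ) {x} N → f 0 ≤ x → x < f N → Σ ℕ λ t → f t ≤ x × x < f (suc t)
bracket f zero    f0≤x x<f0 = ⊥-elim (<⇒≱ x<f0 f0≤x)
bracket f (suc N) f0≤x x<fN with f N ≤? _
... | yes fN≤x = N , fN≤x , x<fN
... | no  fN≰x = bracket f N f0≤x (≰⇒> fN≰x)

n<2^n : ∀ n → n < 2 ^ n
n<2^n zero    = s≤s z≤n
n<2^n (suc n) = +-mono-≤ (m^n>0 2 n) (≤-trans (n<2^n n) (m≤m+n (2 ^ n) 0))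

^-cancelʳ-< : ∀ {m n} → 2 ^ m < 2 ^ n → m < n
^-cancelʳ-< {m} {n} lt = ≰⇒> λ n≤m → <⇒≱ lt (^-monoʳ-≤ 2 n≤m)

^-distribʳ-* : ∀ x y d → (x * y) ^ d ≡ x ^ d * y ^ d
^-distribʳ-* x y zero    = refl
^-distribʳ-* x y (suc d) = trans (cong (x * y *_) (^-distribʳ-* x y d))
  (solve 4 (λ x y p q → x :* y :* (p :* q) := x :* p :* (y :* q)) refl x y (x ^ d) (y ^ d))

-- BigDeg says 2 ^ (n / d) < log₂ n ≤ ℓ; only the much weaker n / d < ℓ is needed.
bigDeg⇒n<ℓ*d : ∀ {n d ℓ} → n ≤ 2 ^ ℓ → BigDeg n d → n < ℓ * d
bigDeg⇒n<ℓ*d {n} {d} {ℓ} n≤2^ℓ (a , b , 2^n*b^d<a^d , 2^a<n^b) = ^-cancelʳ-< (begin-strict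
  2 ^ n        <⟨ *-cancelʳ-< (b ^ d) (2 ^ n) (ℓ ^ d) (<-≤-trans 2^n*b^d<a^d a^d≤[ℓb]^d) ⟩
  ℓ ^ d        ≤⟨ ^-monoˡ-≤ d (<⇒≤ (n<2^n ℓ)) ⟩
  (2 ^ ℓ) ^ d  ≡⟨ ^-*-assoc 2 ℓ d ⟩
  2 ^ (ℓ * d)  ∎)
  where
  open ≤-Reasoning
  a<ℓ*b : a < ℓ * b
  a<ℓ*b = ^-cancelʳ-< (<-≤-trans 2^a<n^b (≤-trans (^-monoˡ-≤ b n≤2^ℓ) (≤-reflexive (^-*-assoc 2 ℓ b))))
  a^d≤[ℓb]^d : a ^ d ≤ ℓ ^ d * b ^ d
  a^d≤[ℓb]^d = ≤-trans (^-monoˡ-≤ d (<⇒≤ a<ℓ*b)) (≤-reflexive (^-distribʳ-* ℓ b d))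

^7-step : ∀ ℓ → 64 ≤ ℓ → suc ℓ ^ 7 ≤ 2 * ℓ ^ 7
^7-step ℓ 64≤ℓ = *-cancelˡ-≤ (64 ^ 7) (begin
  64 ^ 7 * suc ℓ ^ 7     ≡⟨ ^-distribʳ-* 64 (suc ℓ) 7 ⟨
  (64 * suc ℓ) ^ 7       ≤⟨ ^-monoˡ-≤ 7 (≤-trans (≤-reflexive (*-suc 64 ℓ)) (+-monoˡ-≤ _ 64≤ℓ)) ⟩
  (65 * ℓ) ^ 7           ≡⟨ ^-distribʳ-* 65 ℓ 7 ⟩
  65 ^ 7 * ℓ ^ 7         ≤⟨ *-monoˡ-≤ (ℓ ^ 7) (≤ᵇ⇒≤ (65 ^ 7) (64 ^ 7 * 2) _) ⟩
  64 ^ 7 * 2 * ℓ ^ 7     ≡⟨ *-assoc (64 ^ 7) 2 (ℓ ^ 7) ⟩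
  64 ^ 7 * (2 * ℓ ^ 7)   ∎)
  where open ≤-Reasoning

2^20*ℓ^7≤2^ℓ : ∀ ℓ → 64 ≤ ℓ → 2 ^ 20 * ℓ ^ 7 ≤ 2 ^ ℓ
2^20*ℓ^7≤2^ℓ ℓ 64≤ℓ = subst (λ ℓ → 2 ^ 20 * ℓ ^ 7 ≤ 2 ^ ℓ) (m∸n+n≡m 64≤ℓ) (beyond-64 (ℓ ∸ 64))
  where
  -- Written t + 64 rather than 64 + t so that 2 ^ (t + 64) does not unfold 64 times.
  beyond-64 : ∀ t → 2 ^ 20 * (t + 64) ^ 7 ≤ 2 ^ (t + 64)
  beyond-64 zero    = ≤ᵇ⇒≤ (2 ^ 20 * 64 ^ 7) (2 ^ 64) _
  beyond-64 (suc t) = begin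
    2 ^ 20 * suc (t + 64) ^ 7    ≤⟨ *-monoʳ-≤ (2 ^ 20) (^7-step (t + 64) (m≤n+m 64 t)) ⟩
    2 ^ 20 * (2 * (t + 64) ^ 7)
      ≡⟨ solve 2 (λ p q → p :* (con 2 :* q) := con 2 :* (p :* q)) refl (2 ^ 20) ((t + 64) ^ 7) ⟩
    2 * (2 ^ 20 * (t + 64) ^ 7)  ≤⟨ *-monoʳ-≤ 2 (beyond-64 t) ⟩
    2 * 2 ^ (t + 64)             ∎
    where open ≤-Reasoning

open AffinePlane using (order)

cube : ℕ → ℕ
cube a = a * (a * a)

order≡3*cube : ∀ a → order a ≡ 3 * cube a
order≡3*cube a = solve 1 (λ a → (a :* a :+ a :* a) :* a :+ a :* a :* a := con 3 :* (a :* (a :* a))) refl a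

cube-mono : ∀ {a b} → a ≤ b → cube a ≤ cube b
cube-mono a≤b = *-mono-≤ a≤b (*-mono-≤ a≤b a≤b)

order-mono : ∀ {a b} → a ≤ b → order a ≤ order b
order-mono {a} {b} a≤b =
  subst₂ _≤_ (sym (order≡3*cube a)) (sym (order≡3*cube b)) (*-monoʳ-≤ 3 (cube-mono a≤b))

order-c*ℓ² : ∀ c ℓ → 2 * (order (c * (ℓ * ℓ)) * ℓ) ≡ 6 * cube c * ℓ ^ 7
order-c*ℓ² c ℓ = trans (cong (λ o → 2 * (o * ℓ)) (order≡3*cube (c * (ℓ * ℓ))))
  (solve 2 (λ c ℓ → con 2 :* (con 3 :* ((c :* (ℓ :* ℓ)) :* ((c :* (ℓ :* ℓ)) :* (c :* (ℓ :* ℓ)))) :* ℓ)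
                    := con 6 :* (c :* (c :* c)) :* ℓ :^ 7) refl c ℓ)

n<order[1+n]*ℓ : ∀ n ℓ → .{{NonZero ℓ}} → n < order (suc n) * ℓ
n<order[1+n]*ℓ n ℓ = begin-strict
  n                   <⟨ n<1+n n ⟩
  suc n               ≤⟨ m≤m*n (suc n) (suc n * suc n) ⟩
  cube (suc n)        ≤⟨ m≤n*m (cube (suc n)) 3 ⟩
  3 * cube (suc n)    ≡⟨ order≡3*cube (suc n) ⟨
  order (suc n)       ≤⟨ m≤m*n (order (suc n)) ℓ ⟩
  order (suc n) * ℓ   ∎
  where open ≤-Reasoning

module Parameters (C n d ℓ a : ℕ) (ℓ-large : C + 64 ≤ ℓ) (n≤2^ℓ : n ≤ 2 ^ ℓ) (2^ℓ≤2n : 2 ^ ℓ ≤ 2 * n)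
                  (n<ℓd : n < ℓ * d) (lower : order a * ℓ ≤ n) (upper : n < order (suc a) * ℓ)
                  where

  64≤ℓ : 64 ≤ ℓ
  64≤ℓ = ≤-trans (m≤n+m 64 C) ℓ-large

  1+C≤ℓ : 1 + C ≤ ℓ
  1+C≤ℓ = ≤-trans (≤-reflexive (+-comm 1 C)) (≤-trans (+-monoʳ-≤ C (s≤s z≤n)) ℓ-large)

  48ℓ²≤a : 48 * (ℓ * ℓ) ≤ a
  48ℓ²≤a = ≮⇒≥ λ a<48ℓ² → <⇒≱ upper (≤-trans (*-monoˡ-≤ ℓ (order-mono a<48ℓ²)) small-gadget)
    where
    small-gadget : order (48 * (ℓ * ℓ)) * ℓ ≤ n
    small-gadget = *-cancelˡ-≤ 2 (begin
      2 * (order (48 * (ℓ * ℓ)) * ℓ)  ≡⟨ order-c*ℓ² 48 ℓ ⟩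
      6 * cube 48 * ℓ ^ 7             ≤⟨ *-monoˡ-≤ (ℓ ^ 7) (≤ᵇ⇒≤ (6 * cube 48) (2 ^ 20) _) ⟩
      2 ^ 20 * ℓ ^ 7                  ≤⟨ 2^20*ℓ^7≤2^ℓ ℓ 64≤ℓ ⟩
      2 ^ ℓ                           ≤⟨ 2^ℓ≤2n ⟩
      2 * n                           ∎)
      where open ≤-Reasoning

  ℓ≥1 : 1 ≤ ℓ
  ℓ≥1 = ≤-trans (s≤s z≤n) 64≤ℓ

  a≥1 : 1 ≤ a
  a≥1 = ≤-trans (*-mono-≤ {1} {48} (s≤s z≤n) (*-mono-≤ ℓ≥1 ℓ≥1)) 48ℓ²≤a

  order>0 : 0 < order a
  order>0 = ≤-trans (*-mono-≤ {1} {3} (s≤s z≤n) (cube-mono a≥1)) (≤-reflexive (sym (order≡3*cube a)))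

  room : order a ≤ suc d
  room = m<n⇒m≤1+n (*-cancelʳ-< ℓ (order a) d (≤-<-trans lower (subst (n <_) (*-comm ℓ d) n<ℓd)))

  fits : (order a + n) * ℓ + C * n ≤ a * (a * (a * a))
  fits = begin
    (order a + n) * ℓ + C * n
      ≡⟨ solve 4 (λ o n ℓ C → (o :+ n) :* ℓ :+ C :* n := o :* ℓ :+ (n :* ℓ :+ C :* n)) refl (order a) n ℓ C ⟩
    order a * ℓ + (n * ℓ + C * n)   ≤⟨ +-monoˡ-≤ (n * ℓ + C * n) lower ⟩
    n + (n * ℓ + C * n)
      ≡⟨ solve 3 (λ n ℓ C → n :+ (n :* ℓ :+ C :* n) := n :* (ℓ :+ (con 1 :+ C))) refl n ℓ C ⟩
    n * (ℓ + (1 + C))               ≤⟨ *-monoʳ-≤ n (+-monoʳ-≤ ℓ 1+C≤ℓ) ⟩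
    n * (ℓ + ℓ)                     ≤⟨ *-monoˡ-≤ (ℓ + ℓ) n≤24cube*ℓ ⟩
    24 * cube a * ℓ * (ℓ + ℓ)
      ≡⟨ solve 2 (λ c ℓ → con 24 :* c :* ℓ :* (ℓ :+ ℓ) := c :* (con 48 :* (ℓ :* ℓ))) refl (cube a) ℓ ⟩
    cube a * (48 * (ℓ * ℓ))         ≤⟨ *-monoʳ-≤ (cube a) 48ℓ²≤a ⟩
    cube a * a                      ≡⟨ *-comm (cube a) a ⟩
    a * (a * (a * a))               ∎
    where
    open ≤-Reasoning
    n≤24cube*ℓ : n ≤ 24 * cube a * ℓ
    n≤24cube*ℓ = ≤-trans (<⇒≤ upper) (*-monoˡ-≤ ℓ (begin
      order (suc a)      ≡⟨ order≡3*cube (suc a) ⟩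
      3 * cube (suc a)   ≤⟨ *-monoʳ-≤ 3 (cube-mono (+-monoˡ-≤ a a≥1)) ⟩
      3 * cube (a + a)
        ≡⟨ solve 1 (λ a → con 3 :* ((a :+ a) :* ((a :+ a) :* (a :+ a))) := con 24 :* (a :* (a :* a))) refl a ⟩
      24 * cube a        ∎))

  dense-girth5-rare : 2 ^ (C * n) * countGirth5MaxDeg≥ n d ≤ countGirth5 n
  dense-girth5-rare = Planting.Injectivity.planted-count n d a ℓ (C * n) order>0 room n≤2^ℓ fits

mainTheorem15 : (C : ℕ) → Σ ℕ λ N → (n : ℕ) → N ≤ n → (d : ℕ) → BigDeg n d →
                  2 ^ (C * n) * countGirth5MaxDeg≥ n d ≤ countGirth5 n
mainTheorem15 C = suc (2 ^ (C + 64)) , rare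
  where
  rare : ∀ n → suc (2 ^ (C + 64)) ≤ n → ∀ d → BigDeg n d →
         2 ^ (C * n) * countGirth5MaxDeg≥ n d ≤ countGirth5 n
  rare n N≤n d big with bracket (2 ^_) n (≤-trans (s≤s z≤n) N≤n) (n<2^n n)
  ... | t , 2^t≤n , n<2^ℓ with bracket (λ a → order a * suc t) (suc n) z≤n (n<order[1+n]*ℓ n (suc t))
  ... | a , lower , upper =
    Parameters.dense-girth5-rare C n d (suc t) a (<⇒≤ (^-cancelʳ-< (<-trans N≤n n<2^ℓ))) (<⇒≤ n<2^ℓ)
      (*-monoʳ-≤ 2 2^t≤n) (bigDeg⇒n<ℓ*d {n} {d} {suc t} (<⇒≤ n<2^ℓ) big) lower upper
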